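{- For all $n\ge1$, $a_{\{0112,0120\}}(n)=2^{n-1}+\binom{n+1}{4}$.
   Context: An ascent in an integer sequence $s_1\cdots s_m$ is an index $j$ with $s_j<s_{j+1}$; $\mathrm{asc}(s)$ is the number of ascents. An ascent sequence is a sequence $x_1\cdots x_n$ of nonnegative integers with $x_1=0$ and $x_i\le 1+\mathrm{asc}(x_1\cdots x_{i-1})$ for $i\ge2$. For a sequence $w$, $\mathrm{red}(w)$ replaces the $i$-th smallest distinct letter of $w$ by $i-1$. A pattern (e.g. $0112$, meaning the sequence $(0,1,1,2)$) is a sequence equal to its reduction. A sequence $x$ contains pattern $p=p_1\cdots p_k$ if there are indices $i_1<\cdots<i_k$ with $\mathrm{red}(x_{i_1}\cdots x_{i_k})=p$; otherwise it avoids $p$. For a set of patterns $P$, $\mathcal A_n(P)$ is the set of ascent sequences of length $n$ avoiding every pattern in $P$, and $a_P(n)=|\mathcal A_n(P)|$. -}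

module Defs where

open import Data.Bool using (Bool; true; false; _∧_; if_then_else_)
open import Data.Nat using (ℕ; zero; suc; _+_; _<ᵇ_; _≤ᵇ_; _≡ᵇ_)
open import Data.List using (List; []; _∷_; map; length; filter; deduplicateᵇ; _++_)
open import Data.Bool.ListAction using (any; all)
open import Data.List.Properties using (≡-dec)
open import Data.Nat.Properties using (_≟_)
open import Relation.Nullary using (does)
open import Relation.Nullary.Decidable using (yes; no)
import Data.Nat as ℕ

asc : List ℕ → ℕ
asc (a ∷ b ∷ s) = (if a <ᵇ b then 1 else 0) + asc (b ∷ s)
asc _ = 0

ascentCond : List ℕ → List ℕ → Bool
ascentCond pre [] = true
ascentCond pre (x ∷ rest) = (x ≤ᵇ suc (asc pre)) ∧ ascentCond (pre ++ (x ∷ [])) rest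

-- ascent sequence: x_1 = 0 and x_i ≤ 1 + asc(x_1 ⋯ x_{i-1}) for i ≥ 2
-- (the empty sequence is not used: the theorem concerns n ≥ 1)
isAscentSeq : List ℕ → Bool
isAscentSeq [] = true
isAscentSeq (x ∷ rest) = (x ≡ᵇ 0) ∧ ascentCond (x ∷ []) rest

-- red(w): the i-th smallest distinct letter of w becomes i-1, i.e. a letter a
-- becomes the number of distinct letters of w smaller than a
red : List ℕ → List ℕ
red w = map (λ a → length (deduplicateᵇ _≡ᵇ_ (filter (λ b → b ℕ.<? a) w))) w

subseqs : List ℕ → List (List ℕ)
subseqs [] = [] ∷ []
subseqs (x ∷ xs) = subseqs xs ++ map (x ∷_) (subseqs xs)

eqList : List ℕ → List ℕ → Bool
eqList u v = does (≡-dec _≟_ u v)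

contains : List ℕ → List ℕ → Bool
contains x p = any (λ s → eqList (red s) p) (subseqs x)

avoidsAll : List (List ℕ) → List ℕ → Bool
avoidsAll P x = all (λ p → Data.Bool.not (contains x p)) P
  where import Data.Bool

p0112 : List ℕ
p0112 = 0 ∷ 1 ∷ 1 ∷ 2 ∷ []

p0120 : List ℕ
p0120 = 0 ∷ 1 ∷ 2 ∷ 0 ∷ []

-- The sequences in question are the 0-1 sequences starting with 0, of which there are 2^(n-1),
-- and the sequences 0^a 1 0^b 2 3 ⋯ m m^c (m-1)^d with a ≥ 1 and m ≥ 2, of which there are
-- C(n+1,4) since a - 1, b, c, d, m - 2 are arbitrary naturals with sum n - 3.  Both families are
-- read off a deterministic automaton: invariants attached to its states show that the next letter
-- is accepted exactly when it neither breaks the ascent condition nor completes a 0112 or a 0120.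
-- Counting the accepted continuations of length k state by state, with Pascal's rule, gives
-- 2^k + C(k+2,4) from the initial state.

{-# OPTIONS --safe #-}
module Submission where

open import Defs
open import Data.Nat using (ℕ; _+_; _^_; _∸_; _≤_)
open import Data.Nat.Combinatorics using (_C_)
open import Data.Vec using (Vec; toList)
open import Data.Fin using (Fin)
open import Data.Product using (Σ)
open import Data.Bool using (T; _∧_)
open import Data.List using (_∷_; [])
open import Function.Bundles using (_↔_)

open import Data.Bool using (Bool; true; false; not; if_then_else_)
open import Data.Bool.Properties using (T-∧; T-irrelevant; ∧-assoc; ∧-identityʳ)
open import Data.Empty using (⊥-elim)
import Data.Fin as Fin
open import Data.Fin.Properties using (+↔⊎)
open import Data.List using (List; _++_; [_]; map; length; filter; deduplicate; deduplicateᵇ)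
open import Data.List.Membership.Propositional using (_∈_; find; lose)
open import Data.List.Membership.Propositional.Properties using (∈-++⁺ˡ; ∈-++⁺ʳ; ∈-++⁻; ∈-map⁺; ∈-map⁻; ∈-filter⁺)
open import Data.List.Properties
  using (≡-dec; ∷ʳ-injective; ++-identityʳ; ++-assoc; filter-accept; filter-reject; filter-none; length-filter; filter-notAll)
open import Data.List.Relation.Binary.Sublist.Propositional using (_⊆_; []; _∷_; _∷ʳ_; minimum; ⊆-refl; ⊆-trans)
open import Data.List.Relation.Binary.Sublist.Propositional.Properties using (++⁺; ++⁺ʳ; ∷ˡ⁻; All-resp-⊆)
open import Data.List.Relation.Unary.All using (All; []; _∷_)
import Data.List.Relation.Unary.All as All
open import Data.List.Relation.Unary.All.Properties using (∷ʳ⁺)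
open import Data.List.Relation.Unary.Any using (here; there)
open import Data.List.Relation.Unary.Any.Properties using (any⁺; any⁻)
import Data.List.Relation.Unary.Any.Properties as Any
open import Data.Maybe using (Maybe; just; nothing)
open import Data.Nat using (zero; suc; _<_; _<?_; _≡ᵇ_; _<ᵇ_; _≤ᵇ_; z≤n; s≤s)
open import Data.Nat.Combinatorics using (nC1≡n; nCk+nC[k+1]≡[n+1]C[k+1])
open import Data.Nat.ListAction using (sum)
open import Data.Nat.Properties
  using (_≟_; ≤-refl; ≤-trans; <-trans; <-≤-trans; <⇒≤; <⇒≢; ≤⇒≯; ≮⇒≥; n≮n; <-cmp; ≤-pred; n≤1+n; n<1+n;
         m≤n⇒m<n∨m≡n; m≤n+m; m∸n+n≡m; +-assoc; +-comm; +-identityʳ; +-suc;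
         ≡ᵇ⇒≡; ≡⇒≡ᵇ; <⇒<ᵇ; <ᵇ⇒<; ≤ᵇ⇒≤; ≤⇒≤ᵇ; module ≤-Reasoning)
open import Data.Nat.Solver using (module +-*-Solver)
open import Data.Product using (∃; _×_; _,_; proj₁; proj₂)
open import Data.Sum using (_⊎_; inj₁; inj₂; [_,_]′)
open import Data.Sum.Function.Propositional using (_⊎-↔_)
open import Data.Unit using (tt)
open import Data.Vec using ([]; _∷_)
open import Function using (id; _∘_; _∋_; case_of_)
open import Function.Bundles using (_⇔_; mk⇔; Equivalence; mk↔ₛ′)
open import Function.Properties.Equivalence using () renaming (trans to ⇔-trans)
open import Function.Properties.Inverse using (↔-trans; ↔-sym)
open import Relation.Binary.Definitions using (tri<; tri≈; tri>)
open import Relation.Binary.PropositionalEquality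
  using (_≡_; _≢_; _≗_; refl; sym; trans; cong; cong₂; subst; subst₂; module ≡-Reasoning)
open import Relation.Nullary using (¬_; Dec; yes; no; ¬?)
open import Relation.Nullary.Decidable using (T?)
open import Relation.Unary using (Decidable)

module _ {A : Set} {P Q : A → Set} (P? : Decidable P) (Q? : Decidable Q) where

  filter-comm : filter P? ∘ filter Q? ≗ filter Q? ∘ filter P?
  filter-comm [] = refl
  filter-comm (x ∷ xs) with P? x | Q? x
  ... | yes px | yes qx
    rewrite filter-accept P? {xs = filter Q? xs} px | filter-accept Q? {xs = filter P? xs} qx
    = cong (x ∷_) (filter-comm xs)
  ... | yes px | no ¬qx rewrite filter-reject Q? {xs = filter P? xs} ¬qx = filter-comm xs
  ... | no ¬px | yes qx rewrite filter-reject P? {xs = filter Q? xs} ¬px = filter-comm xs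
  ... | no ¬px | no ¬qx = filter-comm xs

  filter-absorbʳ : (∀ {x} → P x → Q x) → filter P? ∘ filter Q? ≗ filter P?
  filter-absorbʳ P⇒Q [] = refl
  filter-absorbʳ P⇒Q (x ∷ xs) with P? x | Q? x
  ... | yes px | yes qx rewrite filter-accept P? {xs = filter Q? xs} px = cong (x ∷_) (filter-absorbʳ P⇒Q xs)
  ... | yes px | no ¬qx = ⊥-elim (¬qx (P⇒Q px))
  ... | no ¬px | yes qx rewrite filter-reject P? {xs = filter Q? xs} ¬px = filter-absorbʳ P⇒Q xs
  ... | no ¬px | no ¬qx = filter-absorbʳ P⇒Q xs

module _ {A : Set} {R : A → A → Set} (R? : ∀ x y → Dec (R x y)) where

  deduplicate-filter : ∀ {P : A → Set} (P? : Decidable P) → (∀ {x y} → R x y → P y → P x) →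
                       deduplicate R? ∘ filter P? ≗ filter P? ∘ deduplicate R?
  deduplicate-filter P? resp [] = refl
  deduplicate-filter P? resp (x ∷ xs) with P? x
  ... | yes px rewrite deduplicate-filter P? resp xs =
    cong (x ∷_) (filter-comm (¬? ∘ R? x) P? (deduplicate R? xs))
  ... | no ¬px rewrite deduplicate-filter P? resp xs =
    sym (filter-absorbʳ P? (¬? ∘ R? x) (λ py rxy → ¬px (resp rxy py)) (deduplicate R? xs))

⊆-∷ʳ⁻ : ∀ {s} (x : List ℕ) a → s ⊆ x ++ [ a ] → s ⊆ x ⊎ ∃ λ (s′ : List ℕ) → s ≡ s′ ++ [ a ] × s′ ⊆ x
⊆-∷ʳ⁻ [] a (.a ∷ʳ []) = inj₁ []
⊆-∷ʳ⁻ [] a (refl ∷ []) = inj₂ ([] , refl , [])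
⊆-∷ʳ⁻ (y ∷ x) a (.y ∷ʳ sub) with ⊆-∷ʳ⁻ x a sub
... | inj₁ sub′ = inj₁ (y ∷ʳ sub′)
... | inj₂ (s′ , refl , sub′) = inj₂ (s′ , refl , y ∷ʳ sub′)
⊆-∷ʳ⁻ (y ∷ x) a (refl ∷ sub) with ⊆-∷ʳ⁻ x a sub
... | inj₁ sub′ = inj₁ (refl ∷ sub′)
... | inj₂ (s′ , refl , sub′) = inj₂ (y ∷ s′ , refl , refl ∷ sub′)

⊆-∷ʳ⁺ : ∀ {s x : List ℕ} {a} → s ⊆ x → s ++ [ a ] ⊆ x ++ [ a ]
⊆-∷ʳ⁺ sub = ++⁺ sub (refl ∷ [])

module _ {a b c d a′ b′ c′ d′ : ℕ} where

  ∷⁴-cong : a ≡ a′ → b ≡ b′ → c ≡ c′ → d ≡ d′ → (List ℕ ∋ a ∷ b ∷ c ∷ d ∷ []) ≡ a′ ∷ b′ ∷ c′ ∷ d′ ∷ []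
  ∷⁴-cong refl refl refl refl = refl

  ∷⁴-injective : (List ℕ ∋ a ∷ b ∷ c ∷ d ∷ []) ≡ a′ ∷ b′ ∷ c′ ∷ d′ ∷ [] → a ≡ a′ × b ≡ b′ × c ≡ c′ × d ≡ d′
  ∷⁴-injective refl = refl , refl , refl , refl

T-eqList : ∀ u v → T (eqList u v) ⇔ (u ≡ v)
T-eqList u v with ≡-dec _≟_ u v
... | yes u≡v = mk⇔ (λ _ → u≡v) (λ _ → tt)
... | no u≢v = mk⇔ (λ ()) u≢v

Occurs : List ℕ → List ℕ → Set
Occurs p x = ∃ λ s → s ⊆ x × red s ≡ p

⊆⇒∈-subseqs : ∀ {s x} → s ⊆ x → s ∈ subseqs x
⊆⇒∈-subseqs [] = here refl
⊆⇒∈-subseqs (y ∷ʳ s⊆x) = ∈-++⁺ˡ (⊆⇒∈-subseqs s⊆x)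
⊆⇒∈-subseqs {x = y ∷ x} (refl ∷ s⊆x) = ∈-++⁺ʳ (subseqs x) (∈-map⁺ (y ∷_) (⊆⇒∈-subseqs s⊆x))

∈-subseqs⇒⊆ : ∀ {s} x → s ∈ subseqs x → s ⊆ x
∈-subseqs⇒⊆ [] (here refl) = []
∈-subseqs⇒⊆ (y ∷ x) s∈ with ∈-++⁻ (subseqs x) s∈
... | inj₁ s∈′ = y ∷ʳ ∈-subseqs⇒⊆ x s∈′
... | inj₂ s∈′ with ∈-map⁻ (y ∷_) s∈′
... | s′ , s′∈ , refl = refl ∷ ∈-subseqs⇒⊆ x s′∈

contains⇔Occurs : ∀ x p → T (contains x p) ⇔ Occurs p x
contains⇔Occurs x p = mk⇔ to from
  where
  to : T (contains x p) → Occurs p x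
  to c with find (any⁻ _ (subseqs x) c)
  ... | s , s∈ , red≡p = s , ∈-subseqs⇒⊆ x s∈ , Equivalence.to (T-eqList (red s) p) red≡p
  from : Occurs p x → T (contains x p)
  from (s , s⊆x , red≡p) = any⁺ _ (lose (⊆⇒∈-subseqs s⊆x) (Equivalence.from (T-eqList (red s) p) red≡p))

dedup : List ℕ → List ℕ
dedup = deduplicateᵇ _≡ᵇ_

-- By definition, red s = map (λ a → rank a s) s.
rank : ℕ → List ℕ → ℕ
rank a s = length (dedup (filter (_<? a) s))

module _ (s : List ℕ) where

  rank-via-dedup : ∀ a → rank a s ≡ length (filter (_<? a) (dedup s))
  rank-via-dedup a = cong length (deduplicate-filter (λ x y → T? (x ≡ᵇ y)) (_<? a) resp s)
    where
    resp : ∀ {x y} → T (x ≡ᵇ y) → y < a → x < a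
    resp {x} {y} x≡ᵇy = subst (_< a) (sym (≡ᵇ⇒≡ x y x≡ᵇy))

  ∈-dedup : ∀ {a} → a ∈ s → a ∈ dedup s
  ∈-dedup = Any.deduplicate⁺ (λ x y → T? (x ≡ᵇ y)) (λ {x} {y} y≡ᵇx a≡x → trans a≡x (sym (≡ᵇ⇒≡ y x y≡ᵇx)))

  rank-mono : ∀ {a b} → a ≤ b → rank a s ≤ rank b s
  rank-mono {a} {b} a≤b = begin
    rank a s                                   ≡⟨ rank-via-dedup a ⟩
    length (filter (_<? a) D)                  ≡⟨ cong length (filter-absorbʳ (_<? a) (_<? b) (λ c<a → <-≤-trans c<a a≤b) D) ⟨
    length (filter (_<? a) (filter (_<? b) D)) ≤⟨ length-filter (_<? a) (filter (_<? b) D) ⟩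
    length (filter (_<? b) D)                  ≡⟨ rank-via-dedup b ⟨
    rank b s                                   ∎
    where open ≤-Reasoning; D = dedup s

  rank-strict : ∀ {a b} → a ∈ s → a < b → rank a s < rank b s
  rank-strict {a} {b} a∈s a<b = begin-strict
    rank a s                                   ≡⟨ rank-via-dedup a ⟩
    length (filter (_<? a) D)                  ≡⟨ cong length (filter-absorbʳ (_<? a) (_<? b) (λ c<a → <-trans c<a a<b) D) ⟨
    length (filter (_<? a) (filter (_<? b) D)) <⟨ filter-notAll (_<? a) _ (lose (∈-filter⁺ (_<? b) (∈-dedup a∈s) a<b) (n≮n a)) ⟩
    length (filter (_<? b) D)                  ≡⟨ rank-via-dedup b ⟨
    rank b s                                   ∎
    where open ≤-Reasoning; D = dedup s

  rank-<⇒< : ∀ {a b} → rank a s < rank b s → a < b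
  rank-<⇒< {a} {b} r<r with a <? b
  ... | yes a<b = a<b
  ... | no a≮b = ⊥-elim (≤⇒≯ (rank-mono (≮⇒≥ a≮b)) r<r)

  rank-injective : ∀ {a b} → a ∈ s → b ∈ s → rank a s ≡ rank b s → a ≡ b
  rank-injective {a} {b} a∈s b∈s r≡r with <-cmp a b
  ... | tri< a<b _ _ = ⊥-elim (<⇒≢ (rank-strict a∈s a<b) r≡r)
  ... | tri≈ _ a≡b _ = a≡b
  ... | tri> _ _ b<a = ⊥-elim (<⇒≢ (rank-strict b∈s b<a) (sym r≡r))

private
  -- dedup (x ∷ l) unfolds to x ∷ filter (other? x) (dedup l).
  other? : ∀ x y → Dec (¬ T (x ≡ᵇ y))
  other? x y = ¬? (T? (x ≡ᵇ y))

  filter-other-≢ : ∀ {x y} l → x ≢ y → filter (other? x) (y ∷ l) ≡ y ∷ filter (other? x) l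
  filter-other-≢ {x} {y} l x≢y = filter-accept (other? x) (λ x≡ᵇy → x≢y (≡ᵇ⇒≡ x y x≡ᵇy))

  filter-other-self : ∀ x l → filter (other? x) (x ∷ l) ≡ filter (other? x) l
  filter-other-self x l = filter-reject (other? x) (λ x≢x → x≢x (≡⇒≡ᵇ x x refl))

  dedup-uvv : ∀ {u v} → u ≢ v → dedup (u ∷ v ∷ v ∷ []) ≡ u ∷ v ∷ []
  dedup-uvv {u} {v} u≢v = cong (u ∷_) (begin
    filter (other? u) (v ∷ filter (other? v) (v ∷ [])) ≡⟨ cong (filter (other? u) ∘ (v ∷_)) (filter-other-self v []) ⟩
    filter (other? u) (v ∷ [])                         ≡⟨ filter-other-≢ [] u≢v ⟩
    v ∷ []                                             ∎)
    where open ≡-Reasoning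

  dedup-uvu : ∀ {u v} → u ≢ v → dedup (u ∷ v ∷ u ∷ []) ≡ u ∷ v ∷ []
  dedup-uvu {u} {v} u≢v = cong (u ∷_) (begin
    filter (other? u) (v ∷ filter (other? v) (u ∷ [])) ≡⟨ cong (filter (other? u) ∘ (v ∷_)) (filter-other-≢ [] (u≢v ∘ sym)) ⟩
    filter (other? u) (v ∷ u ∷ [])                     ≡⟨ filter-other-≢ (u ∷ []) u≢v ⟩
    v ∷ filter (other? u) (u ∷ [])                     ≡⟨ cong (v ∷_) (filter-other-self u []) ⟩
    v ∷ []                                             ∎)
    where open ≡-Reasoning

  rank-least : ∀ {a} s → All (a ≤_) s → rank a s ≡ 0
  rank-least {a} s a≤s = cong (length ∘ dedup) (filter-none (_<? a) (All.map ≤⇒≯ a≤s))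

red-0112 : ∀ {u v z} → u < v → v < z → red (u ∷ v ∷ v ∷ z ∷ []) ≡ p0112
red-0112 {u} {v} {z} u<v v<z = ∷⁴-cong rank₀ rank₁ rank₁ rank₂
  where
  s = u ∷ v ∷ v ∷ z ∷ []
  u<z = <-trans u<v v<z
  below-v : filter (_<? v) s ≡ u ∷ []
  below-v = trans (filter-accept (_<? v) u<v) (cong (u ∷_) (filter-none (_<? v) (n≮n v ∷ n≮n v ∷ ≤⇒≯ (<⇒≤ v<z) ∷ [])))
  below-z : filter (_<? z) s ≡ u ∷ v ∷ v ∷ []
  below-z = trans (filter-accept (_<? z) u<z) (cong (u ∷_)
            (trans (filter-accept (_<? z) v<z) (cong (v ∷_)
            (trans (filter-accept (_<? z) v<z) (cong (v ∷_) (filter-none (_<? z) (n≮n z ∷ [])))))))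
  rank₀ : rank u s ≡ 0
  rank₀ = rank-least s (≤-refl ∷ <⇒≤ u<v ∷ <⇒≤ u<v ∷ <⇒≤ u<z ∷ [])
  rank₁ : rank v s ≡ 1
  rank₁ = cong (length ∘ dedup) below-v
  rank₂ : rank z s ≡ 2
  rank₂ = cong length (trans (cong dedup below-z) (dedup-uvv (<⇒≢ u<v)))

red-0120 : ∀ {u v w} → u < v → v < w → red (u ∷ v ∷ w ∷ u ∷ []) ≡ p0120
red-0120 {u} {v} {w} u<v v<w = ∷⁴-cong rank₀ rank₁ rank₂ rank₀
  where
  s = u ∷ v ∷ w ∷ u ∷ []
  u<w = <-trans u<v v<w
  below-v : filter (_<? v) s ≡ u ∷ u ∷ []
  below-v = trans (filter-accept (_<? v) u<v) (cong (u ∷_)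
            (trans (filter-reject (_<? v) (n≮n v))
            (trans (filter-reject (_<? v) (≤⇒≯ (<⇒≤ v<w))) (filter-accept (_<? v) u<v))))
  below-w : filter (_<? w) s ≡ u ∷ v ∷ u ∷ []
  below-w = trans (filter-accept (_<? w) u<w) (cong (u ∷_)
            (trans (filter-accept (_<? w) v<w) (cong (v ∷_)
            (trans (filter-reject (_<? w) (n≮n w)) (filter-accept (_<? w) u<w)))))
  rank₀ : rank u s ≡ 0
  rank₀ = rank-least s (≤-refl ∷ <⇒≤ u<v ∷ <⇒≤ u<w ∷ ≤-refl ∷ [])
  rank₁ : rank v s ≡ 1
  rank₁ = cong length (trans (cong dedup below-v) (cong (u ∷_) (filter-other-self u [])))
  rank₂ : rank w s ≡ 2
  rank₂ = cong length (trans (cong dedup below-w) (dedup-uvu (<⇒≢ u<v)))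

data Contains0112 (x : List ℕ) : Set where
  contains0112 : ∀ {u v z} → u < v → v < z → u ∷ v ∷ v ∷ z ∷ [] ⊆ x → Contains0112 x

data Contains0120 (x : List ℕ) : Set where
  contains0120 : ∀ {u v w} → u < v → v < w → u ∷ v ∷ w ∷ u ∷ [] ⊆ x → Contains0120 x

red≡0112⇒ : ∀ s → red s ≡ p0112 → Contains0112 s
red≡0112⇒ (u ∷ v ∷ w ∷ z ∷ []) red≡ with ∷⁴-injective red≡
... | r-u , r-v , r-w , r-z
    with rank-injective (u ∷ v ∷ w ∷ z ∷ []) (there (here refl)) (there (there (here refl))) (trans r-v (sym r-w))
... | refl = contains0112 (rank-<⇒< s (subst₂ _<_ (sym r-u) (sym r-v) (s≤s z≤n)))
                          (rank-<⇒< s (subst₂ _<_ (sym r-w) (sym r-z) (s≤s (s≤s z≤n)))) ⊆-refl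
  where s = u ∷ v ∷ v ∷ z ∷ []

red≡0120⇒ : ∀ s → red s ≡ p0120 → Contains0120 s
red≡0120⇒ (u ∷ v ∷ w ∷ z ∷ []) red≡ with ∷⁴-injective red≡
... | r-u , r-v , r-w , r-z
    with rank-injective (u ∷ v ∷ w ∷ z ∷ []) (there (there (there (here refl)))) (here refl) (trans r-z (sym r-u))
... | refl = contains0120 (rank-<⇒< s (subst₂ _<_ (sym r-u) (sym r-v) (s≤s z≤n)))
                          (rank-<⇒< s (subst₂ _<_ (sym r-v) (sym r-w) (s≤s (s≤s z≤n)))) ⊆-refl
  where s = u ∷ v ∷ w ∷ u ∷ []

Occurs⇔Contains0112 : ∀ x → Occurs p0112 x ⇔ Contains0112 x
Occurs⇔Contains0112 x = mk⇔ to from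
  where
  to : Occurs p0112 x → Contains0112 x
  to (s , s⊆x , red≡) with red≡0112⇒ s red≡
  ... | contains0112 u<v v<z sub = contains0112 u<v v<z (⊆-trans sub s⊆x)
  from : Contains0112 x → Occurs p0112 x
  from (contains0112 u<v v<z sub) = _ , sub , red-0112 u<v v<z

Occurs⇔Contains0120 : ∀ x → Occurs p0120 x ⇔ Contains0120 x
Occurs⇔Contains0120 x = mk⇔ to from
  where
  to : Occurs p0120 x → Contains0120 x
  to (s , s⊆x , red≡) with red≡0120⇒ s red≡
  ... | contains0120 u<v v<w sub = contains0120 u<v v<w (⊆-trans sub s⊆x)
  from : Contains0120 x → Occurs p0120 x
  from (contains0120 u<v v<w sub) = _ , sub , red-0120 u<v v<w

T-∧-not-not : ∀ a b c → T (a ∧ (not b ∧ (not c ∧ true))) ⇔ (T a × ¬ T b × ¬ T c)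
T-∧-not-not false b c = mk⇔ (λ ()) proj₁
T-∧-not-not true true c = mk⇔ (λ ()) (λ (_ , ¬b , _) → ¬b tt)
T-∧-not-not true false true = mk⇔ (λ ()) (λ (_ , _ , ¬c) → ¬c tt)
T-∧-not-not true false false = mk⇔ (λ _ → tt , (λ ()) , (λ ())) (λ _ → tt)

T-contains0112 : ∀ x → T (contains x p0112) ⇔ Contains0112 x
T-contains0112 x = ⇔-trans (contains⇔Occurs x p0112) (Occurs⇔Contains0112 x)

T-contains0120 : ∀ x → T (contains x p0120) ⇔ Contains0120 x
T-contains0120 x = ⇔-trans (contains⇔Occurs x p0120) (Occurs⇔Contains0120 x)

Good : List ℕ → Set
Good x = T (isAscentSeq x ∧ avoidsAll (p0112 ∷ p0120 ∷ []) x)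

Good⇔ : ∀ x → Good x ⇔ (T (isAscentSeq x) × ¬ Contains0112 x × ¬ Contains0120 x)
Good⇔ x = mk⇔
  (λ good → let ascent , ¬0112 , ¬0120 = Equivalence.to bools good in
    ascent , ¬0112 ∘ Equivalence.from (T-contains0112 x) , ¬0120 ∘ Equivalence.from (T-contains0120 x))
  (λ (ascent , ¬0112 , ¬0120) → Equivalence.from bools
    (ascent , ¬0112 ∘ Equivalence.to (T-contains0112 x) , ¬0120 ∘ Equivalence.to (T-contains0120 x)))
  where bools = T-∧-not-not (isAscentSeq x) (contains x p0112) (contains x p0120)

lastOf : ℕ → List ℕ → ℕ
lastOf h [] = h
lastOf h (y ∷ t) = lastOf y t

lastOf-∷ʳ : ∀ h t a → lastOf h (t ++ [ a ]) ≡ a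
lastOf-∷ʳ h [] a = refl
lastOf-∷ʳ h (y ∷ t) a = lastOf-∷ʳ y t a

All-lastOf : ∀ {P : ℕ → Set} h t → All P (h ∷ t) → P (lastOf h t)
All-lastOf h [] (ph ∷ []) = ph
All-lastOf h (y ∷ t) (_ ∷ pt) = All-lastOf y t pt

asc-∷ʳ : ∀ h t a → asc ((h ∷ t) ++ [ a ]) ≡ asc (h ∷ t) + asc (lastOf h t ∷ a ∷ [])
asc-∷ʳ h [] a = refl
asc-∷ʳ h (y ∷ t) a = trans (cong (ascent +_) (asc-∷ʳ y t a)) (sym (+-assoc ascent (asc (y ∷ t)) _))
  where ascent = if h <ᵇ y then 1 else 0

asc-pair-< : ∀ {l a} → l < a → asc (l ∷ a ∷ []) ≡ 1
asc-pair-< {l} {a} l<a with l <ᵇ a | <⇒<ᵇ l<a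
... | true | _ = refl

asc-pair-≮ : ∀ {l a} → ¬ l < a → asc (l ∷ a ∷ []) ≡ 0
asc-pair-≮ {l} {a} l≮a with l <ᵇ a in l<ᵇa
... | false = refl
... | true = ⊥-elim (l≮a (<ᵇ⇒< l a (subst T (sym l<ᵇa) tt)))

asc-∷ʳ-> : ∀ h t {a c} → asc (h ∷ t) ≡ c → lastOf h t < a → asc ((h ∷ t) ++ [ a ]) ≡ suc c
asc-∷ʳ-> h t {a} {c} refl l<a = trans (asc-∷ʳ h t a) (trans (cong (c +_) (asc-pair-< l<a)) (+-comm c 1))

asc-∷ʳ-≤ : ∀ h t {a c} → asc (h ∷ t) ≡ c → a ≤ lastOf h t → asc ((h ∷ t) ++ [ a ]) ≡ c
asc-∷ʳ-≤ h t {a} {c} refl a≤l = trans (asc-∷ʳ h t a) (trans (cong (c +_) (asc-pair-≮ (≤⇒≯ a≤l))) (+-identityʳ c))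

ascentCond-∷ʳ : ∀ pre t a → ascentCond pre (t ++ [ a ]) ≡ ascentCond pre t ∧ (a ≤ᵇ suc (asc (pre ++ t)))
ascentCond-∷ʳ pre [] a rewrite ++-identityʳ pre = ∧-identityʳ _
ascentCond-∷ʳ pre (b ∷ t) a rewrite ascentCond-∷ʳ (pre ++ [ b ]) t a | ++-assoc pre [ b ] t =
  sym (∧-assoc (b ≤ᵇ suc (asc pre)) (ascentCond (pre ++ [ b ]) t) _)

ascentCond-++⁻ : ∀ pre t r → T (ascentCond pre (t ++ r)) → T (ascentCond pre t)
ascentCond-++⁻ pre [] r _ = tt
ascentCond-++⁻ pre (b ∷ t) r cond with Equivalence.to T-∧ cond
... | b≤ , cond′ = Equivalence.from T-∧ (b≤ , ascentCond-++⁻ (pre ++ [ b ]) t r cond′)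

isAscentSeq-∷ʳ : ∀ h t a → isAscentSeq ((h ∷ t) ++ [ a ]) ≡ isAscentSeq (h ∷ t) ∧ (a ≤ᵇ suc (asc (h ∷ t)))
isAscentSeq-∷ʳ h t a rewrite ascentCond-∷ʳ [ h ] t a = sym (∧-assoc (h ≡ᵇ 0) (ascentCond [ h ] t) _)

isAscentSeq-++⁻ : ∀ x r → T (isAscentSeq (x ++ r)) → T (isAscentSeq x)
isAscentSeq-++⁻ [] r _ = tt
isAscentSeq-++⁻ (h ∷ t) r ascent with Equivalence.to T-∧ ascent
... | h≡0 , cond = Equivalence.from T-∧ (h≡0 , ascentCond-++⁻ [ h ] t r cond)

data Completes0112 (x : List ℕ) (a : ℕ) : Set where
  completes0112 : ∀ {u v} → u < v → v < a → u ∷ v ∷ v ∷ [] ⊆ x → Completes0112 x a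

data Completes0120 (x : List ℕ) (a : ℕ) : Set where
  completes0120 : ∀ {v w} → a < v → v < w → a ∷ v ∷ w ∷ [] ⊆ x → Completes0120 x a

Contains0112-∷ʳ⁻ : ∀ x a → Contains0112 (x ++ [ a ]) → Contains0112 x ⊎ Completes0112 x a
Contains0112-∷ʳ⁻ x a (contains0112 u<v v<z sub) with ⊆-∷ʳ⁻ x a sub
... | inj₁ sub′ = inj₁ (contains0112 u<v v<z sub′)
... | inj₂ (s′ , eq , sub′) with ∷ʳ-injective (_ ∷ _ ∷ _ ∷ []) s′ eq
... | refl , refl = inj₂ (completes0112 u<v v<z sub′)

Contains0120-∷ʳ⁻ : ∀ x a → Contains0120 (x ++ [ a ]) → Contains0120 x ⊎ Completes0120 x a
Contains0120-∷ʳ⁻ x a (contains0120 u<v v<w sub) with ⊆-∷ʳ⁻ x a sub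
... | inj₁ sub′ = inj₁ (contains0120 u<v v<w sub′)
... | inj₂ (s′ , eq , sub′) with ∷ʳ-injective (_ ∷ _ ∷ _ ∷ []) s′ eq
... | refl , refl = inj₂ (completes0120 u<v v<w sub′)

Completes0112⇒Contains0112 : ∀ {x a} → Completes0112 x a → Contains0112 (x ++ [ a ])
Completes0112⇒Contains0112 (completes0112 u<v v<a sub) = contains0112 u<v v<a (⊆-∷ʳ⁺ sub)

Completes0120⇒Contains0120 : ∀ {x a} → Completes0120 x a → Contains0120 (x ++ [ a ])
Completes0120⇒Contains0120 (completes0120 a<v v<w sub) = contains0120 a<v v<w (⊆-∷ʳ⁺ sub)

Good-++⁻ : ∀ x r → Good (x ++ r) → Good x
Good-++⁻ x r good with Equivalence.to (Good⇔ (x ++ r)) good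
... | ascent , ¬0112 , ¬0120 = Equivalence.from (Good⇔ x)
  ( isAscentSeq-++⁻ x r ascent
  , (λ { (contains0112 u<v v<z sub) → ¬0112 (contains0112 u<v v<z (++⁺ʳ r sub)) })
  , (λ { (contains0120 u<v v<w sub) → ¬0120 (contains0120 u<v v<w (++⁺ʳ r sub)) }))

Good-∷ʳ⁻ : ∀ h t a → Good ((h ∷ t) ++ [ a ]) →
  a ≤ suc (asc (h ∷ t)) × ¬ Completes0112 (h ∷ t) a × ¬ Completes0120 (h ∷ t) a
Good-∷ʳ⁻ h t a good with Equivalence.to (Good⇔ ((h ∷ t) ++ [ a ])) good
... | ascent , ¬0112 , ¬0120 =
  ≤ᵇ⇒≤ a _ (proj₂ (Equivalence.to T-∧ (subst T (isAscentSeq-∷ʳ h t a) ascent))) ,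
  ¬0112 ∘ Completes0112⇒Contains0112 ,
  ¬0120 ∘ Completes0120⇒Contains0120

Good-∷ʳ⁺ : ∀ h t a → Good (h ∷ t) →
  a ≤ suc (asc (h ∷ t)) → ¬ Completes0112 (h ∷ t) a → ¬ Completes0120 (h ∷ t) a → Good ((h ∷ t) ++ [ a ])
Good-∷ʳ⁺ h t a good a≤ ¬ends0112 ¬ends0120 with Equivalence.to (Good⇔ (h ∷ t)) good
... | ascent , ¬0112 , ¬0120 = Equivalence.from (Good⇔ ((h ∷ t) ++ [ a ]))
  ( subst T (sym (isAscentSeq-∷ʳ h t a)) (Equivalence.from T-∧ (ascent , ≤⇒≤ᵇ a≤))
  , [ ¬0112 , ¬ends0112 ]′ ∘ Contains0112-∷ʳ⁻ (h ∷ t) a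
  , [ ¬0120 , ¬ends0120 ]′ ∘ Contains0120-∷ʳ⁻ (h ∷ t) a)

Bounded : ℕ → List ℕ → Set
Bounded m = All (_≤ m)

-- No letter a ≤ tb completes a 0112 in x.
Tops011≥ : ℕ → List ℕ → Set
Tops011≥ tb x = ∀ {u v} → u < v → u ∷ v ∷ v ∷ [] ⊆ x → tb ≤ v

Bounded-weaken : ∀ {m m′ x} → m ≤ m′ → Bounded m x → Bounded m′ x
Bounded-weaken m≤m′ = All.map (λ a≤m → ≤-trans a≤m m≤m′)

Tops011≥-weaken : ∀ {tb tb′ x} → tb′ ≤ tb → Tops011≥ tb x → Tops011≥ tb′ x
Tops011≥-weaken tb′≤tb tops u<v sub = ≤-trans tb′≤tb (tops u<v sub)

Tops011≥-vacuous : ∀ {m tb tb′ x} → Bounded m x → m < tb → Tops011≥ tb x → Tops011≥ tb′ x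
Tops011≥-vacuous bounded m<tb tops u<v sub with All-resp-⊆ sub bounded
... | _ ∷ v≤m ∷ _ = ⊥-elim (≤⇒≯ v≤m (<-≤-trans m<tb (tops u<v sub)))

Tops011≥-∷ʳ : ∀ {tb x a} → Tops011≥ tb x → (∀ {u} → u < a → u ∷ a ∷ [] ⊆ x → tb ≤ a) → Tops011≥ tb (x ++ [ a ])
Tops011≥-∷ʳ {x = x} tops new u<v sub with ⊆-∷ʳ⁻ x _ sub
... | inj₁ sub′ = tops u<v sub′
... | inj₂ (s′ , eq , sub′) with ∷ʳ-injective (_ ∷ _ ∷ []) s′ eq
... | refl , refl = new u<v sub′

Tops011≥-∷ʳ-fresh : ∀ {m tb x a} → Bounded m x → m < a → Tops011≥ tb x → Tops011≥ tb (x ++ [ a ])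
Tops011≥-∷ʳ-fresh bounded m<a tops = Tops011≥-∷ʳ tops λ _ sub → case All-resp-⊆ sub bounded of λ where
  (_ ∷ a≤m ∷ []) → ⊥-elim (≤⇒≯ a≤m m<a)

Tops011≥-1 : ∀ {x} → Tops011≥ 1 x
Tops011≥-1 u<v _ = ≤-trans (s≤s z≤n) u<v

-- A new 0120 a v w a needs w ≥ a + 2, which m ≤ a + 1 rules out.
Good-∷ʳ-allowed : ∀ {m tb c} h t {a} → Good (h ∷ t) → Bounded m (h ∷ t) → Tops011≥ tb (h ∷ t) → asc (h ∷ t) ≡ c →
  m ≤ suc a → a ≤ tb → a ≤ suc c → Good ((h ∷ t) ++ [ a ])
Good-∷ʳ-allowed h t {a} good bounded tops refl m≤1+a a≤tb a≤ = Good-∷ʳ⁺ h t a good a≤ ¬ends0112 ¬ends0120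
  where
  ¬ends0112 : ¬ Completes0112 (h ∷ t) a
  ¬ends0112 (completes0112 u<v v<a sub) = ≤⇒≯ (≤-trans a≤tb (tops u<v sub)) v<a
  ¬ends0120 : ¬ Completes0120 (h ∷ t) a
  ¬ends0120 (completes0120 a<v v<w sub) with All-resp-⊆ sub bounded
  ... | _ ∷ _ ∷ w≤m ∷ [] = ≤⇒≯ (≤-trans w≤m m≤1+a) (<-≤-trans (s≤s a<v) v<w)

module _ (h : ℕ) (t : List ℕ) {a : ℕ} where

  ¬Good-∷ʳ-asc : ∀ {c} → asc (h ∷ t) ≡ c → suc c < a → ¬ Good ((h ∷ t) ++ [ a ])
  ¬Good-∷ʳ-asc refl 1+c<a good = ≤⇒≯ (proj₁ (Good-∷ʳ⁻ h t a good)) 1+c<a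

  ¬Good-∷ʳ-0112 : ∀ {u v} → u < v → v < a → u ∷ v ∷ v ∷ [] ⊆ h ∷ t → ¬ Good ((h ∷ t) ++ [ a ])
  ¬Good-∷ʳ-0112 u<v v<a sub good = proj₁ (proj₂ (Good-∷ʳ⁻ h t a good)) (completes0112 u<v v<a sub)

  ¬Good-∷ʳ-0120 : ∀ {v w} → a < v → v < w → a ∷ v ∷ w ∷ [] ⊆ h ∷ t → ¬ Good ((h ∷ t) ++ [ a ])
  ¬Good-∷ʳ-0120 a<v v<w sub good = proj₂ (proj₂ (Good-∷ʳ⁻ h t a good)) (completes0120 a<v v<w sub)

-- After reading an ascent sequence x avoiding 0112 and 0120 the automaton is in state
--   zeros        if x ∈ 0⁺,
--   single       if x ∈ 0⁺ 1 0*,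
--   binary       if x is a 0-1 sequence with at least two 1s,
--   climbing K   if x ∈ 0⁺ 1 0* 2 3 ⋯ (K+1),
--   plateau K    if x ∈ 0⁺ 1 0* 2 3 ⋯ (K+1) (K+1)⁺,
--   descended K  if x ∈ 0⁺ 1 0* 2 3 ⋯ (K+1) (K+1)* K⁺;
-- the letters base s, base s + 1, … lead from s to the states listed in successors s.
data State : Set where
  zeros single binary : State
  climbing plateau descended : ℕ → State

base : State → ℕ
base (climbing K) = K
base (plateau K) = K
base (descended K) = K
base _ = 0

successors : State → List State
successors zeros = zeros ∷ single ∷ []
successors single = single ∷ binary ∷ climbing 1 ∷ []
successors binary = binary ∷ binary ∷ []
successors (climbing K) = descended K ∷ plateau K ∷ climbing (suc K) ∷ []
successors (plateau K) = descended K ∷ plateau K ∷ []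
successors (descended K) = descended K ∷ []

lookupFrom : ℕ → List State → ℕ → Maybe State
lookupFrom (suc b) ss zero = nothing
lookupFrom (suc b) ss (suc a) = lookupFrom b ss a
lookupFrom zero [] a = nothing
lookupFrom zero (s ∷ ss) zero = just s
lookupFrom zero (s ∷ ss) (suc a) = lookupFrom zero ss a

step : State → ℕ → Maybe State
step s = lookupFrom (base s) (successors s)

accepts : Maybe State → List ℕ → Bool
accepts nothing r = false
accepts (just s) [] = true
accepts (just s) (a ∷ r) = accepts (step s a) r

lookupFrom-below : ∀ {b a} ss → a < b → lookupFrom b ss a ≡ nothing
lookupFrom-below {suc b} {zero} ss _ = refl
lookupFrom-below {suc b} {suc a} ss (s≤s a<b) = lookupFrom-below ss a<b

lookupFrom-shift : ∀ b ss i → lookupFrom b ss (i + b) ≡ lookupFrom zero ss i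
lookupFrom-shift zero ss i = cong (lookupFrom zero ss) (+-identityʳ i)
lookupFrom-shift (suc b) ss i rewrite +-suc i b = lookupFrom-shift b ss i

data Offset (b : ℕ) : ℕ → Set where
  below : ∀ {a} → a < b → Offset b a
  at : ∀ i → Offset b (i + b)

offset : ∀ b a → Offset b a
offset b a with a <? b
... | yes a<b = below a<b
... | no a≮b = subst (Offset b) (m∸n+n≡m (≮⇒≥ a≮b)) (at (a ∸ b))

-- Becomes TriplesBelow (suc K) once 2 + K is appended.
PairsUpTo : ℕ → List ℕ → Set
PairsUpTo K x = ∀ {b} → b ≤ K → b ∷ suc K ∷ [] ⊆ x

-- Every letter below K completes a 0120 in x.
TriplesBelow : ℕ → List ℕ → Set
TriplesBelow K x = ∀ {b} → b < K → b ∷ K ∷ suc K ∷ [] ⊆ x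

Inv : State → List ℕ → Set
Inv zeros t = Bounded 0 (0 ∷ t) × Tops011≥ 2 (0 ∷ t) × asc (0 ∷ t) ≡ 0
Inv single t = Bounded 1 (0 ∷ t) × Tops011≥ 2 (0 ∷ t) × asc (0 ∷ t) ≡ 1 × 0 ∷ 1 ∷ [] ⊆ 0 ∷ t
Inv binary t = Bounded 1 (0 ∷ t) × 0 ∷ 1 ∷ 1 ∷ [] ⊆ 0 ∷ t
Inv (climbing K) t = 1 ≤ K × Bounded (suc K) (0 ∷ t) × Tops011≥ (2 + K) (0 ∷ t) × asc (0 ∷ t) ≡ suc K ×
  lastOf 0 t ≡ suc K × PairsUpTo K (0 ∷ t) × TriplesBelow K (0 ∷ t)
Inv (plateau K) t = 1 ≤ K × Bounded (suc K) (0 ∷ t) × Tops011≥ (suc K) (0 ∷ t) × asc (0 ∷ t) ≡ suc K ×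
  lastOf 0 t ≡ suc K × TriplesBelow K (0 ∷ t) × 0 ∷ suc K ∷ suc K ∷ [] ⊆ 0 ∷ t
Inv (descended K) t = 1 ≤ K × Bounded (suc K) (0 ∷ t) × Tops011≥ K (0 ∷ t) × asc (0 ∷ t) ≡ suc K ×
  lastOf 0 t ≡ K × TriplesBelow K (0 ∷ t) × 0 ∷ K ∷ K ∷ [] ⊆ 0 ∷ t

Outcome : List ℕ → ℕ → Maybe State → Set
Outcome t a nothing = ¬ Good ((0 ∷ t) ++ [ a ])
Outcome t a (just s) = Good ((0 ∷ t) ++ [ a ]) × Inv s (t ++ [ a ])

step-zeros : ∀ t → Inv zeros t → Good (0 ∷ t) → ∀ a → Outcome t a (step zeros a)
step-zeros t (bounded , tops , asc≡0) good 0 =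
  Good-∷ʳ-allowed 0 t good bounded tops asc≡0 z≤n z≤n z≤n ,
  ∷ʳ⁺ bounded z≤n , Tops011≥-∷ʳ tops (λ ()) , asc-∷ʳ-≤ 0 t asc≡0 z≤n
step-zeros t (bounded , tops , asc≡0) good 1 =
  Good-∷ʳ-allowed 0 t good bounded tops asc≡0 z≤n (s≤s z≤n) ≤-refl ,
  ∷ʳ⁺ (Bounded-weaken z≤n bounded) ≤-refl , Tops011≥-∷ʳ-fresh bounded (s≤s z≤n) tops ,
  asc-∷ʳ-> 0 t asc≡0 (s≤s (All-lastOf 0 t bounded)) , ⊆-∷ʳ⁺ (refl ∷ minimum t)
step-zeros t (_ , _ , asc≡0) _ (suc (suc a)) =
  ¬Good-∷ʳ-asc 0 t asc≡0 (s≤s (s≤s z≤n))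

step-single : ∀ t → Inv single t → Good (0 ∷ t) → ∀ a → Outcome t a (step single a)
step-single t (bounded , tops , asc≡1 , 01⊆) good 0 =
  Good-∷ʳ-allowed 0 t good bounded tops asc≡1 ≤-refl z≤n z≤n ,
  ∷ʳ⁺ bounded z≤n , Tops011≥-∷ʳ tops (λ ()) , asc-∷ʳ-≤ 0 t asc≡1 z≤n , ++⁺ʳ [ 0 ] 01⊆
step-single t (bounded , tops , asc≡1 , 01⊆) good 1 =
  Good-∷ʳ-allowed 0 t good bounded tops asc≡1 (s≤s z≤n) (s≤s z≤n) (s≤s z≤n) ,
  ∷ʳ⁺ bounded ≤-refl , ⊆-∷ʳ⁺ 01⊆
step-single t (bounded , tops , asc≡1 , 01⊆) good 2 =
  Good-∷ʳ-allowed 0 t good bounded tops asc≡1 (s≤s z≤n) ≤-refl ≤-refl ,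
  ≤-refl , ∷ʳ⁺ (Bounded-weaken (n≤1+n 1) bounded) ≤-refl ,
  Tops011≥-∷ʳ-fresh bounded ≤-refl (Tops011≥-vacuous bounded ≤-refl tops) ,
  asc-∷ʳ-> 0 t asc≡1 (s≤s (All-lastOf 0 t bounded)) , lastOf-∷ʳ 0 t 2 , pairs , triples
  where
  pairs : PairsUpTo 1 ((0 ∷ t) ++ [ 2 ])
  pairs {0} _ = ⊆-∷ʳ⁺ (refl ∷ minimum t)
  pairs {1} _ = ⊆-∷ʳ⁺ (∷ˡ⁻ 01⊆)
  pairs {suc (suc _)} (s≤s ())
  triples : TriplesBelow 1 ((0 ∷ t) ++ [ 2 ])
  triples {0} _ = ⊆-∷ʳ⁺ 01⊆
  triples {suc _} (s≤s ())
step-single t (_ , _ , asc≡1 , _) _ (suc (suc (suc a))) = ¬Good-∷ʳ-asc 0 t asc≡1 (s≤s (s≤s (s≤s z≤n)))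

step-binary : ∀ t → Inv binary t → Good (0 ∷ t) → ∀ a → Outcome t a (step binary a)
step-binary t (bounded , 011⊆) good 0 =
  Good-∷ʳ-allowed 0 t good bounded Tops011≥-1 refl ≤-refl z≤n z≤n , ∷ʳ⁺ bounded z≤n , ++⁺ʳ [ 0 ] 011⊆
step-binary t (bounded , 011⊆) good 1 =
  Good-∷ʳ-allowed 0 t good bounded Tops011≥-1 refl (s≤s z≤n) ≤-refl (s≤s z≤n) , ∷ʳ⁺ bounded ≤-refl , ++⁺ʳ [ 1 ] 011⊆
step-binary t (_ , 011⊆) _ (suc (suc a)) = ¬Good-∷ʳ-0112 0 t (s≤s z≤n) (s≤s (s≤s z≤n)) 011⊆

module _ (K : ℕ) (t : List ℕ) {tb : ℕ} (1≤K : 1 ≤ K) (bounded : Bounded (suc K) (0 ∷ t))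
         (tops : Tops011≥ tb (0 ∷ t)) (asc≡ : asc (0 ∷ t) ≡ suc K) (triples : TriplesBelow K (0 ∷ t))
         (good : Good (0 ∷ t)) where

  enter-descended : K ≤ tb → K ≤ lastOf 0 t → Outcome t K (just (descended K))
  enter-descended K≤tb K≤last =
    Good-∷ʳ-allowed 0 t good bounded tops asc≡ ≤-refl K≤tb (≤-trans (n≤1+n K) (n≤1+n (suc K))) ,
    1≤K , ∷ʳ⁺ bounded (n≤1+n K) , Tops011≥-∷ʳ (Tops011≥-weaken K≤tb tops) (λ _ _ → ≤-refl) ,
    asc-∷ʳ-≤ 0 t asc≡ K≤last , lastOf-∷ʳ 0 t K ,
    ++⁺ʳ [ K ] ∘ triples , ⊆-∷ʳ⁺ (⊆-trans (refl ∷ refl ∷ _ ∷ʳ []) (triples 1≤K))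

  enter-plateau : suc K ≤ tb → lastOf 0 t ≡ suc K → 0 ∷ suc K ∷ [] ⊆ 0 ∷ t → Outcome t (suc K) (just (plateau K))
  enter-plateau 1+K≤tb last≡ 0,1+K⊆ =
    Good-∷ʳ-allowed 0 t good bounded tops asc≡ (n≤1+n (suc K)) 1+K≤tb (n≤1+n (suc K)) ,
    1≤K , ∷ʳ⁺ bounded ≤-refl , Tops011≥-∷ʳ (Tops011≥-weaken 1+K≤tb tops) (λ _ _ → ≤-refl) ,
    asc-∷ʳ-≤ 0 t asc≡ (subst (suc K ≤_) (sym last≡) ≤-refl) , lastOf-∷ʳ 0 t (suc K) ,
    ++⁺ʳ [ suc K ] ∘ triples , ⊆-∷ʳ⁺ 0,1+K⊆

reject-below : ∀ K t {a} → TriplesBelow K (0 ∷ t) → a < K → ¬ Good ((0 ∷ t) ++ [ a ])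
reject-below K t triples a<K = ¬Good-∷ʳ-0120 0 t a<K (n<1+n K) (triples a<K)

reject-above : ∀ K t e → asc (0 ∷ t) ≡ suc K → ¬ Good ((0 ∷ t) ++ [ 3 + e + K ])
reject-above K t e asc≡ = ¬Good-∷ʳ-asc 0 t asc≡ (s≤s (s≤s (s≤s (m≤n+m K e))))

step-climbing : ∀ K t → Inv (climbing K) t → Good (0 ∷ t) → ∀ a → Outcome t a (step (climbing K) a)
step-climbing K t (1≤K , bounded , tops , asc≡ , last≡ , pairs , triples) good a with offset K a
... | below a<K rewrite lookupFrom-below (successors (climbing K)) a<K =
  reject-below K t triples a<K
... | at 0 rewrite lookupFrom-shift K (successors (climbing K)) 0 =
  enter-descended K t 1≤K bounded tops asc≡ triples good (≤-trans (n≤1+n K) (n≤1+n (suc K)))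
    (subst (K ≤_) (sym last≡) (n≤1+n K))
... | at 1 rewrite lookupFrom-shift K (successors (climbing K)) 1 =
  enter-plateau K t 1≤K bounded tops asc≡ triples good (n≤1+n (suc K)) last≡ (pairs z≤n)
... | at 2 rewrite lookupFrom-shift K (successors (climbing K)) 2 =
  Good-∷ʳ-allowed 0 t good bounded tops asc≡ (≤-trans (n≤1+n (suc K)) (n≤1+n (2 + K))) ≤-refl ≤-refl ,
  s≤s z≤n , ∷ʳ⁺ (Bounded-weaken (n≤1+n (suc K)) bounded) ≤-refl ,
  Tops011≥-∷ʳ-fresh bounded ≤-refl (Tops011≥-vacuous bounded ≤-refl tops) ,
  asc-∷ʳ-> 0 t asc≡ (subst (_< 2 + K) (sym last≡) ≤-refl) , lastOf-∷ʳ 0 t (2 + K) ,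
  pairs′ , ⊆-∷ʳ⁺ ∘ pairs ∘ ≤-pred
  where
  pairs′ : PairsUpTo (suc K) ((0 ∷ t) ++ [ 2 + K ])
  pairs′ b≤1+K with m≤n⇒m<n∨m≡n b≤1+K
  ... | inj₁ b<1+K = ⊆-∷ʳ⁺ (⊆-trans (refl ∷ _ ∷ʳ []) (pairs (≤-pred b<1+K)))
  ... | inj₂ refl = ⊆-∷ʳ⁺ (∷ˡ⁻ (pairs z≤n))
... | at (suc (suc (suc e))) rewrite lookupFrom-shift K (successors (climbing K)) (3 + e) =
  reject-above K t e asc≡

step-plateau : ∀ K t → Inv (plateau K) t → Good (0 ∷ t) → ∀ a → Outcome t a (step (plateau K) a)
step-plateau K t (1≤K , bounded , tops , asc≡ , last≡ , triples , 0,1+K,1+K⊆) good a with offset K a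
... | below a<K rewrite lookupFrom-below (successors (plateau K)) a<K =
  reject-below K t triples a<K
... | at 0 rewrite lookupFrom-shift K (successors (plateau K)) 0 =
  enter-descended K t 1≤K bounded tops asc≡ triples good (n≤1+n K) (subst (K ≤_) (sym last≡) (n≤1+n K))
... | at 1 rewrite lookupFrom-shift K (successors (plateau K)) 1 =
  enter-plateau K t 1≤K bounded tops asc≡ triples good ≤-refl last≡ (⊆-trans (refl ∷ refl ∷ _ ∷ʳ []) 0,1+K,1+K⊆)
... | at 2 rewrite lookupFrom-shift K (successors (plateau K)) 2 =
  ¬Good-∷ʳ-0112 0 t (s≤s z≤n) ≤-refl 0,1+K,1+K⊆
... | at (suc (suc (suc e))) rewrite lookupFrom-shift K (successors (plateau K)) (3 + e) =
  reject-above K t e asc≡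

step-descended : ∀ K t → Inv (descended K) t → Good (0 ∷ t) → ∀ a → Outcome t a (step (descended K) a)
step-descended K t (1≤K , bounded , tops , asc≡ , last≡ , triples , 0,K,K⊆) good a with offset K a
... | below a<K rewrite lookupFrom-below (successors (descended K)) a<K =
  reject-below K t triples a<K
... | at 0 rewrite lookupFrom-shift K (successors (descended K)) 0 =
  enter-descended K t 1≤K bounded tops asc≡ triples good ≤-refl (subst (K ≤_) (sym last≡) ≤-refl)
... | at 1 rewrite lookupFrom-shift K (successors (descended K)) 1 =
  ¬Good-∷ʳ-0112 0 t 1≤K ≤-refl 0,K,K⊆
... | at 2 rewrite lookupFrom-shift K (successors (descended K)) 2 =
  ¬Good-∷ʳ-0112 0 t 1≤K (n≤1+n (suc K)) 0,K,K⊆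
... | at (suc (suc (suc e))) rewrite lookupFrom-shift K (successors (descended K)) (3 + e) =
  reject-above K t e asc≡

step-sound : ∀ s t → Inv s t → Good (0 ∷ t) → ∀ a → Outcome t a (step s a)
step-sound zeros = step-zeros
step-sound single = step-single
step-sound binary = step-binary
step-sound (climbing K) = step-climbing K
step-sound (plateau K) = step-plateau K
step-sound (descended K) = step-descended K

Good-++⇔accepts : ∀ s t r → Inv s t → Good (0 ∷ t) → Good ((0 ∷ t) ++ r) ⇔ T (accepts (just s) r)
Good-++⇔accepts s t [] inv good = mk⇔ (λ _ → tt) (λ _ → subst Good (sym (++-identityʳ (0 ∷ t))) good)
Good-++⇔accepts s t (a ∷ r) inv good =
  subst (λ y → Good y ⇔ T (accepts (step s a) r)) (++-assoc (0 ∷ t) [ a ] r) (continue (step s a) (step-sound s t inv good a))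
  where
  continue : ∀ m → Outcome t a m → Good (((0 ∷ t) ++ [ a ]) ++ r) ⇔ T (accepts m r)
  continue nothing bad = mk⇔ (bad ∘ Good-++⁻ ((0 ∷ t) ++ [ a ]) r) (λ ())
  continue (just s′) (good′ , inv′) = Good-++⇔accepts s′ (t ++ [ a ]) r inv′ good′

Good⇔accepts : ∀ t → Good (0 ∷ t) ⇔ T (accepts (just zeros) t)
Good⇔accepts t = Good-++⇔accepts zeros [] t ((z≤n ∷ []) , (λ { _ (_ ∷ʳ ()) ; _ (_ ∷ ()) }) , refl) tt

Words : Maybe State → ℕ → Set
Words m k = Σ (Vec ℕ k) (λ v → T (accepts m (toList v)))

count : State → ℕ → ℕ
count s zero = 1
count s (suc k) = sum (map (λ s′ → count s′ k) (successors s))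

uncons-Σℕ : ∀ {F : ℕ → Set} → Σ ℕ F ↔ (F 0 ⊎ Σ ℕ (F ∘ suc))
uncons-Σℕ {F} = mk↔ₛ′ to from to∘from from∘to
  where
  to : Σ ℕ F → F 0 ⊎ Σ ℕ (F ∘ suc)
  to (zero , f) = inj₁ f
  to (suc a , f) = inj₂ (a , f)
  from : F 0 ⊎ Σ ℕ (F ∘ suc) → Σ ℕ F
  from (inj₁ f) = zero , f
  from (inj₂ (a , f)) = suc a , f
  to∘from : ∀ y → to (from y) ≡ y
  to∘from (inj₁ f) = refl
  to∘from (inj₂ (a , f)) = refl
  from∘to : ∀ x → from (to x) ≡ x
  from∘to (zero , f) = refl
  from∘to (suc a , f) = refl

Words-∷ : ∀ s k → Words (just s) (suc k) ↔ Σ ℕ (λ a → Words (step s a) k)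
Words-∷ s k = mk↔ₛ′ (λ { (a ∷ v , acc) → a , v , acc }) (λ (a , v , acc) → a ∷ v , acc) (λ _ → refl) (λ { (_ ∷ _ , _) → refl })

rejected-⊎ : ∀ {A : Set} k → (Words nothing k ⊎ A) ↔ A
rejected-⊎ k = mk↔ₛ′ [ (λ { (_ , ()) }) , id ]′ inj₂ (λ _ → refl) λ { (inj₁ (_ , ())) ; (inj₂ _) → refl }

Words-count : ∀ s k → Words (just s) k ↔ Fin (count s k)
Words-lookupFrom : ∀ b ss k → Σ ℕ (λ a → Words (lookupFrom b ss a) k) ↔ Fin (sum (map (λ s → count s k) ss))

Words-count s zero = mk↔ₛ′ (λ _ → Fin.zero) (λ _ → [] , tt) (λ { Fin.zero → refl ; (Fin.suc ()) }) (λ { ([] , tt) → refl })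
Words-count s (suc k) = ↔-trans (Words-∷ s k) (Words-lookupFrom (base s) (successors s) k)

Words-lookupFrom (suc b) ss k = ↔-trans uncons-Σℕ (↔-trans (rejected-⊎ k) (Words-lookupFrom b ss k))
Words-lookupFrom zero [] k = mk↔ₛ′ (λ { (_ , _ , ()) }) (λ ()) (λ ()) (λ { (_ , _ , ()) })
Words-lookupFrom zero (s ∷ ss) k =
  ↔-trans uncons-Σℕ (↔-trans (Words-count s k ⊎-↔ Words-lookupFrom zero ss k) (↔-sym +↔⊎))

count-descended : ∀ K k → count (descended K) k ≡ 1
count-descended K zero = refl
count-descended K (suc k) = trans (+-identityʳ _) (count-descended K k)

count-plateau : ∀ K k → count (plateau K) k ≡ suc k
count-plateau K zero = refl
count-plateau K (suc k) = cong₂ _+_ (count-descended K k) (trans (+-identityʳ _) (count-plateau K k))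

count-climbing : ∀ K k → count (climbing K) k ≡ (2 + k) C 2
count-climbing K zero = refl
count-climbing K (suc k) = begin
  count (descended K) k + (count (plateau K) k + (count (climbing (suc K)) k + 0))
    ≡⟨ cong₂ _+_ (count-descended K k) (cong₂ _+_ (count-plateau K k) (trans (+-identityʳ _) (count-climbing (suc K) k))) ⟩
  (2 + k) + (2 + k) C 2   ≡⟨ cong (_+ (2 + k) C 2) (nC1≡n (2 + k)) ⟨
  (2 + k) C 1 + (2 + k) C 2 ≡⟨ nCk+nC[k+1]≡[n+1]C[k+1] (2 + k) 1 ⟩
  (3 + k) C 2             ∎
  where open ≡-Reasoning

count-binary : ∀ k → count binary k ≡ 2 ^ k
count-binary zero = refl
count-binary (suc k) = cong (λ c → c + (c + 0)) (count-binary k)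

private
  -- a + (a + 0) is 2 * a by definition, hence 2 ^ suc k for a = 2 ^ k.
  regroup : ∀ a b c → (a + b) + (a + c) ≡ (a + (a + 0)) + (c + b)
  regroup = solve 3 (λ a b c → (a :+ b) :+ (a :+ c) := (a :+ (a :+ con 0)) :+ (c :+ b)) refl
    where open +-*-Solver

count-single : ∀ k → count single k ≡ 2 ^ k + (2 + k) C 3
count-single zero = refl
count-single (suc k) = begin
  count single k + (count binary k + (count (climbing 1) k + 0))
    ≡⟨ cong₂ _+_ (count-single k) (cong₂ _+_ (count-binary k) (trans (+-identityʳ _) (count-climbing 1 k))) ⟩
  (2 ^ k + (2 + k) C 3) + (2 ^ k + (2 + k) C 2) ≡⟨ regroup (2 ^ k) _ _ ⟩
  2 ^ suc k + ((2 + k) C 2 + (2 + k) C 3)     ≡⟨ cong (2 ^ suc k +_) (nCk+nC[k+1]≡[n+1]C[k+1] (2 + k) 2) ⟩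
  2 ^ suc k + (3 + k) C 3                     ∎
  where open ≡-Reasoning

count-zeros : ∀ k → count zeros k ≡ 2 ^ k + (2 + k) C 4
count-zeros zero = refl
count-zeros (suc k) = begin
  count zeros k + (count single k + 0)
    ≡⟨ cong₂ _+_ (count-zeros k) (trans (+-identityʳ _) (count-single k)) ⟩
  (2 ^ k + (2 + k) C 4) + (2 ^ k + (2 + k) C 3) ≡⟨ regroup (2 ^ k) _ _ ⟩
  2 ^ suc k + ((2 + k) C 3 + (2 + k) C 4)     ≡⟨ cong (2 ^ suc k +_) (nCk+nC[k+1]≡[n+1]C[k+1] (2 + k) 3) ⟩
  2 ^ suc k + (3 + k) C 4                     ∎
  where open ≡-Reasoning

sequences↔Words : ∀ k → Σ (Vec ℕ (suc k)) (Good ∘ toList) ↔ Words (just zeros) k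
sequences↔Words k = mk↔ₛ′ to from to∘from from∘to
  where
  to : Σ (Vec ℕ (suc k)) (Good ∘ toList) → Words (just zeros) k
  to (0 ∷ v , good) = v , Equivalence.to (Good⇔accepts (toList v)) good
  from : Words (just zeros) k → Σ (Vec ℕ (suc k)) (Good ∘ toList)
  from (v , acc) = 0 ∷ v , Equivalence.from (Good⇔accepts (toList v)) acc
  to∘from : ∀ y → to (from y) ≡ y
  to∘from (v , acc) = cong (v ,_) (T-irrelevant _ _)
  from∘to : ∀ x → from (to x) ≡ x
  from∘to (0 ∷ v , good) = cong (0 ∷ v ,_) (T-irrelevant _ _)

theorem3p6 : ∀ (n : ℕ) → 1 ≤ n →
    (Σ (Vec ℕ n) (λ x → T (isAscentSeq (toList x) ∧ avoidsAll (p0112 ∷ p0120 ∷ []) (toList x))))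
      ↔ Fin (2 ^ (n ∸ 1) + (n + 1) C 4)
theorem3p6 (suc k) _ =
  ↔-trans (sequences↔Words k) (subst (λ c → Words (just zeros) k ↔ Fin c) total (Words-count zeros k))
  where
  total : count zeros k ≡ 2 ^ k + (suc k + 1) C 4
  total = trans (count-zeros k) (cong (λ m → 2 ^ k + m C 4) (+-comm 1 (suc k)))
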